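{- Let $a,b\in\mathbb{Z}\setminus\{0\}$ and $n$ a positive integer. The Diophantine equation $a(x^2-y^{6n})=b(z^6-w^6)$ has infinitely many non-trivial solutions in integers $x,y,z,w$. Moreover, if $b=1$, then the equation has infinitely many non-trivial solutions in coprime integers.
   Context: A solution is called trivial if both sides vanish separately for trivial reasons (e.g. $x^2=y^{6n}$ and $z^6=w^6$); such solutions are discarded. "Coprime integers" means $\gcd(x,y,z,w)=1$. -}

module Defs where

open import Data.Nat using (ℕ)
open import Data.Integer using (ℤ; _*_; _-_; _^_; 1ℤ)
open import Data.Integer.GCD using (gcd)
open import Data.Product using (_×_; _,_; Σ)
open import Data.List using (List)
open import Data.List.Membership.Propositional using (_∉_)
open import Relation.Binary.PropositionalEquality using (_≡_)
open import Relation.Nullary using (¬_)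

Quad : Set
Quad = ℤ × ℤ × ℤ × ℤ

IsSolution : ℤ → ℤ → ℕ → Quad → Set
IsSolution a b n (x , y , z , w) =
  a * (x ^ 2 - y ^ (6 Data.Nat.* n)) ≡ b * (z ^ 6 - w ^ 6)

-- trivial: both sides vanish separately, i.e. x^2 = y^(6n) and z^6 = w^6
IsTrivial : ℕ → Quad → Set
IsTrivial n (x , y , z , w) = (x ^ 2 ≡ y ^ (6 Data.Nat.* n)) × (z ^ 6 ≡ w ^ 6)

Coprime4 : Quad → Set
Coprime4 (x , y , z , w) = gcd (gcd (gcd x y) z) w ≡ 1ℤ

InfinitelyMany : (Quad → Set) → Set
InfinitelyMany P = (L : List Quad) → Σ Quad (λ q → P q × q ∉ L)

-- With u = 3aM², Z = b + u and W = b − u, the polynomial identity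
-- b (Z⁶ − W⁶) = a (X² − V²) holds for X = 10b³M + 54a²bM⁵ and V = 8b³M.
-- Taking M = (2r)³ and any y with yⁿ = 4br gives y^(6n) = (4br)⁶ = V², so
-- (X, y, Z, W) is a solution; it is non-trivial since
-- X² − V² = 2bM(b² + 27a²M⁴) · 18bM(b² + 3a²M⁴) ≠ 0 as soon as b, r ≠ 0.
-- The choice y = 4bt, r = t yⁿ⁻¹ works for every t ≠ 0, and |y| grows with t.
-- For b = 1 the entries Z, W = 1 ± u are coprime because u = 2k is even:
-- (1 − k) Z − k W = 1.
module Submission where

open import Defs
open import Data.Nat using (ℕ; NonZero)
open import Data.Integer using (ℤ; 0ℤ; 1ℤ)
open import Data.Product using (_×_)
open import Relation.Binary.PropositionalEquality using (_≡_; _≢_)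
open import Relation.Nullary using (¬_)

import Data.Nat as ℕ
import Data.Nat.Properties as ℕP
open import Data.Integer using (+_; ∣_∣; _*_; _+_; _-_; _^_; -_; sign; _◃_)
import Data.Integer.Properties as ZP
open import Data.Integer.Tactic.RingSolver using (solve-∀)
open import Data.Integer.Divisibility.Signed using (_∣_; ∣ᵤ⇒∣; ∣⇒∣ᵤ; ∣-trans; ∣n⇒∣m*n; ∣m∣n⇒∣m+n)
open import Data.Integer.GCD using (gcd; gcd[i,j]∣i; gcd[i,j]∣j)
import Data.Nat.Divisibility as ℕD
open import Data.Sign.Properties using (s*s≡+)
open import Data.Product using (_,_)
open import Data.Sum using (inj₁; inj₂)
open import Data.List using (map)
open import Data.List.Extrema.Nat using (max; v≤max⁺)
import Data.List.Relation.Unary.Any as Any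
open import Data.List.Relation.Unary.Any.Properties using (map⁺)
open import Data.List.Membership.Propositional using (_∈_)
open import Relation.Binary.PropositionalEquality using (refl; sym; trans; cong; cong₂; subst; module ≡-Reasoning)

*-≢0 : ∀ {i j} → i ≢ 0ℤ → j ≢ 0ℤ → i * j ≢ 0ℤ
*-≢0 {i} i≢0 j≢0 ij≡0 with ZP.i*j≡0⇒i≡0∨j≡0 i ij≡0
... | inj₁ i≡0 = i≢0 i≡0
... | inj₂ j≡0 = j≢0 j≡0

+[1+n]≢0 : ∀ n → + ℕ.suc n ≢ 0ℤ
+[1+n]≢0 n ()

i*i≡+[∣i∣*∣i∣] : ∀ i → i * i ≡ + (∣ i ∣ ℕ.* ∣ i ∣)
i*i≡+[∣i∣*∣i∣] i = trans (cong (_◃ (∣ i ∣ ℕ.* ∣ i ∣)) (s*s≡+ (sign i))) (ZP.+◃n≡+n _)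

i*i+n*[j*j]≢0 : ∀ {i} j n → i ≢ 0ℤ → i * i + + n * (j * j) ≢ 0ℤ
i*i+n*[j*j]≢0 {i} j n i≢0 eq = *-≢0 i≢0 i≢0 (ZP.∣i∣≡0⇒i≡0 (trans (ZP.abs-* i i) ∣i∣²≡0))
  where
  open ≡-Reasoning
  ∣i∣²≡0 : ∣ i ∣ ℕ.* ∣ i ∣ ≡ 0
  ∣i∣²≡0 = ℕP.m+n≡0⇒m≡0 _ (ZP.+-injective (begin
    + (∣ i ∣ ℕ.* ∣ i ∣ ℕ.+ n ℕ.* (∣ j ∣ ℕ.* ∣ j ∣))   ≡⟨ ZP.pos-+ (∣ i ∣ ℕ.* ∣ i ∣) _ ⟩
    + (∣ i ∣ ℕ.* ∣ i ∣) + + (n ℕ.* (∣ j ∣ ℕ.* ∣ j ∣))  ≡⟨ cong (λ e → + (∣ i ∣ ℕ.* ∣ i ∣) + e) (ZP.pos-* n _) ⟩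
    + (∣ i ∣ ℕ.* ∣ i ∣) + + n * + (∣ j ∣ ℕ.* ∣ j ∣)    ≡⟨ sym (cong₂ (λ s t → s + + n * t) (i*i≡+[∣i∣*∣i∣] i) (i*i≡+[∣i∣*∣i∣] j)) ⟩
    i * i + + n * (j * j)                               ≡⟨ eq ⟩
    0ℤ                                                  ∎))

∣j∣≤∣i*j∣ : ∀ {i j} → i ≢ 0ℤ → ∣ j ∣ ℕ.≤ ∣ i * j ∣
∣j∣≤∣i*j∣ {i} {j} i≢0 = subst (∣ j ∣ ℕ.≤_) (sym (ZP.abs-* i j))
  (ℕP.m≤n*m ∣ j ∣ ∣ i ∣ {{ℕ.≢-nonZero (λ ∣i∣≡0 → i≢0 (ZP.∣i∣≡0⇒i≡0 ∣i∣≡0))}})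

coprime4-bezout : ∀ {x y z w} α β → α * z + β * w ≡ 1ℤ → Coprime4 (x , y , z , w)
coprime4-bezout {x} {y} {z} {w} α β αz+βw≡1 = cong +_ (ℕD.∣1⇒≡1 (∣⇒∣ᵤ {g} {1ℤ} g∣1))
  where
  g′ g : ℤ
  g′ = gcd (gcd x y) z
  g = gcd g′ w
  g∣z : g ∣ z
  g∣z = ∣-trans {g} {g′} {z} (∣ᵤ⇒∣ {g} {g′} (gcd[i,j]∣i g′ w)) (∣ᵤ⇒∣ {g′} {z} (gcd[i,j]∣j (gcd x y) z))
  g∣w : g ∣ w
  g∣w = ∣ᵤ⇒∣ {g} {w} (gcd[i,j]∣j g′ w)
  g∣1 : g ∣ 1ℤ
  g∣1 = subst (g ∣_) αz+βw≡1 (∣m∣n⇒∣m+n (∣n⇒∣m*n α g∣z) (∣n⇒∣m*n β g∣w))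

unbounded⇒infinitelyMany : ∀ {P} (size : Quad → ℕ) (f : ℕ → Quad) →
  (∀ i → P (f i)) → (∀ i → i ℕ.< size (f i)) → InfinitelyMany P
unbounded⇒infinitelyMany size f P[f] i<size L =
  f bound , P[f] bound , λ f[bound]∈L → ℕP.<⇒≱ (i<size bound) (size≤bound f[bound]∈L)
  where
  bound : ℕ
  bound = max 0 (map size L)
  size≤bound : ∀ {q} → q ∈ L → size q ℕ.≤ bound
  size≤bound q∈L = v≤max⁺ 0 (map size L) (inj₂ (map⁺ (Any.map (λ { refl → ℕP.≤-refl }) q∈L)))

-- i ^ 2 and i ^ 6 are written out as their unfoldings (sq, sixth), since the
-- ring solver does not understand the exponentiation of Data.Integer.
sextic-identity : ∀ a b M →
  let sq    = λ i → i * (i * 1ℤ)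
      sixth = λ i → i * (i * (i * (i * (i * (i * 1ℤ)))))
      u = + 3 * a * (M * M)
      x = + 10 * b * b * b * M + + 54 * a * a * b * (M * M * M * M * M)
      v = + 8 * b * b * b * M
  in a * (sq x - sq v) ≡ b * (sixth (b + u) - sixth (b - u))
sextic-identity = solve-∀

sextic-difference-of-squares : ∀ a b M →
  let sq = λ i → i * (i * 1ℤ)
      c : ℤ
      c = a * (M * M)
      x = + 10 * b * b * b * M + + 54 * a * a * b * (M * M * M * M * M)
      v = + 8 * b * b * b * M
  in sq x - sq v ≡ (+ 2 * b * M * (b * b + + 27 * (c * c))) * (+ 18 * b * M * (b * b + + 3 * (c * c)))
sextic-difference-of-squares = solve-∀

sixth-power-identity : ∀ b r →
  let sq    = λ i → i * (i * 1ℤ)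
      sixth = λ i → i * (i * (i * (i * (i * (i * 1ℤ)))))
      m = + 2 * r
      M = m * m * m
  in sixth (+ 4 * b * r) ≡ sq (+ 8 * b * b * b * M)
sixth-power-identity = solve-∀

sextic-bezout : ∀ a r →
  let m = + 2 * r
      M = m * m * m
      u = + 3 * a * (M * M)
      k = + 96 * a * (r * r * r * r * r * r)
  in (1ℤ - k) * (1ℤ + u) + (- k) * (1ℤ - u) ≡ 1ℤ
sextic-bezout = solve-∀

module Sextic (a b : ℤ) where

  cube-of-double : ℤ → ℤ
  cube-of-double r = (+ 2 * r) * (+ 2 * r) * (+ 2 * r)

  X V U : ℤ → ℤ
  X M = + 10 * b * b * b * M + + 54 * a * a * b * (M * M * M * M * M)
  V M = + 8 * b * b * b * M
  U M = + 3 * a * (M * M)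

  solution : ℤ → ℤ → Quad
  solution r y = X M , y , b + U M , b - U M
    where M = cube-of-double r

  module _ {n : ℕ} {r y : ℤ} (yⁿ≡4br : y ^ n ≡ + 4 * b * r) where

    private
      M : ℤ
      M = cube-of-double r

    y^[6n]≡V² : y ^ (6 ℕ.* n) ≡ V M ^ 2
    y^[6n]≡V² = begin
      y ^ (6 ℕ.* n)      ≡⟨ cong (y ^_) (ℕP.*-comm 6 n) ⟩
      y ^ (n ℕ.* 6)      ≡⟨ sym (ZP.^-*-assoc y n 6) ⟩
      (y ^ n) ^ 6        ≡⟨ cong (_^ 6) yⁿ≡4br ⟩
      (+ 4 * b * r) ^ 6  ≡⟨ sixth-power-identity b r ⟩
      V M ^ 2            ∎
      where open ≡-Reasoning

    solution-isSolution : IsSolution a b n (solution r y)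
    solution-isSolution = begin
      a * (X M ^ 2 - y ^ (6 ℕ.* n))              ≡⟨ cong (λ e → a * (X M ^ 2 - e)) y^[6n]≡V² ⟩
      a * (X M ^ 2 - V M ^ 2)                    ≡⟨ sextic-identity a b M ⟩
      b * ((b + U M) ^ 6 - (b - U M) ^ 6)        ∎
      where open ≡-Reasoning

    solution-nonTrivial : b ≢ 0ℤ → y ≢ 0ℤ → ¬ IsTrivial n (solution r y)
    solution-nonTrivial b≢0 y≢0 (x²≡y^[6n] , _) =
      factors≢0 (trans (sym (sextic-difference-of-squares a b M)) (ZP.i≡j⇒i-j≡0 (trans x²≡y^[6n] y^[6n]≡V²)))
      where
      c : ℤ
      c = a * (M * M)
      r≢0 : r ≢ 0ℤ
      r≢0 r≡0 = y≢0 (ZP.i^n≡0⇒i≡0 y n (trans yⁿ≡4br (trans (cong (+ 4 * b *_) r≡0) (ZP.*-zeroʳ (+ 4 * b)))))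
      M≢0 : M ≢ 0ℤ
      M≢0 = *-≢0 (*-≢0 2r≢0 2r≢0) 2r≢0
        where
        2r≢0 : + 2 * r ≢ 0ℤ
        2r≢0 = *-≢0 (+[1+n]≢0 1) r≢0
      [1+k]bM≢0 : ∀ k → + ℕ.suc k * b * M ≢ 0ℤ
      [1+k]bM≢0 k = *-≢0 (*-≢0 (+[1+n]≢0 k) b≢0) M≢0
      factors≢0 : (+ 2 * b * M * (b * b + + 27 * (c * c))) * (+ 18 * b * M * (b * b + + 3 * (c * c))) ≢ 0ℤ
      factors≢0 = *-≢0 (*-≢0 ([1+k]bM≢0 1) (i*i+n*[j*j]≢0 c 27 b≢0)) (*-≢0 ([1+k]bM≢0 17) (i*i+n*[j*j]≢0 c 3 b≢0))

  solution-coprime : b ≡ 1ℤ → ∀ r y → Coprime4 (solution r y)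
  solution-coprime refl r y =
    coprime4-bezout {X M} {y} {1ℤ + U M} {1ℤ - U M} (1ℤ - k) (- k) (sextic-bezout a r)
    where
    M k : ℤ
    M = cube-of-double r
    k = + 96 * a * (r * r * r * r * r * r)

corollary2p2 : (a b : ℤ) → a ≢ 0ℤ → b ≢ 0ℤ → (n : ℕ) → NonZero n →
    InfinitelyMany (λ q → IsSolution a b n q × ¬ IsTrivial n q)
    × (b ≡ 1ℤ → InfinitelyMany (λ q → IsSolution a b n q × ¬ IsTrivial n q × Coprime4 q))
corollary2p2 a b _ b≢0 n@(ℕ.suc k) _ =
    unbounded⇒infinitelyMany {λ q → IsSolution a b n q × ¬ IsTrivial n q}
      ∣y∣ family (λ i → isSolution i , nonTrivial i) growth
  , λ b≡1 → unbounded⇒infinitelyMany {λ q → IsSolution a b n q × ¬ IsTrivial n q × Coprime4 q}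
      ∣y∣ family (λ i → isSolution i , nonTrivial i , solution-coprime b≡1 (r i) (y i)) growth
  where
  open Sextic a b
  4b≢0 : + 4 * b ≢ 0ℤ
  4b≢0 = *-≢0 (+[1+n]≢0 3) b≢0
  y r : ℕ → ℤ
  y i = + 4 * b * + ℕ.suc i
  r i = + ℕ.suc i * y i ^ k
  family : ℕ → Quad
  family i = solution (r i) (y i)
  yⁿ≡4br : ∀ i → y i ^ n ≡ + 4 * b * r i
  yⁿ≡4br i = ZP.*-assoc (+ 4 * b) (+ ℕ.suc i) (y i ^ k)
  isSolution : ∀ i → IsSolution a b n (family i)
  isSolution i = solution-isSolution {n} {r i} {y i} (yⁿ≡4br i)
  nonTrivial : ∀ i → ¬ IsTrivial n (family i)
  nonTrivial i = solution-nonTrivial {n} {r i} {y i} (yⁿ≡4br i) b≢0 (*-≢0 4b≢0 (+[1+n]≢0 i))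
  ∣y∣ : Quad → ℕ
  ∣y∣ (_ , y′ , _ , _) = ∣ y′ ∣
  growth : ∀ i → i ℕ.< ∣y∣ (family i)
  growth i = ∣j∣≤∣i*j∣ 4b≢0
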